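{- Let $w$ be a p-string with $\Pi_w\neq\emptyset$ having periods $p$ and $q$. If $|w|\ge p+q+\min(p,q)\cdot(|\Pi_w|-1)$, then $\gcd(p,q)$ is a period of $w$.
   Context: Let $\Sigma$ and $\Pi$ be disjoint alphabets; a p-string is a string over $\Sigma\cup\Pi$, indexed from 0, with $w[i:j]=w[i]\cdots w[j-1]$. A permutation $f$ of $\Pi$ acts on p-strings letterwise, fixing letters of $\Sigma$; $x\equiv y$ iff $f(x)=y$ for some permutation $f$ of $\Pi$. For $p\in\mathbb{N}^+$, $p\le|w|$, $p$ is a period of $w$ iff $w[0:|w|-p]\equiv w[p:|w|]$. $\Pi_w$ is the set of parameter characters occurring in $w$. -}

module Defs where

open import Data.Nat using (ℕ; _≤_; _∸_)
open import Data.List using (List; []; _∷_; length; map; take; drop; deduplicate)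
open import Data.Sum using (_⊎_; inj₁; inj₂; map₂)
open import Data.Product using (Σ; _×_)
open import Function.Bundles using (_↔_; Inverse)
open import Relation.Binary.Definitions using (DecidableEquality)
open import Relation.Binary.PropositionalEquality using (_≡_)

-- A p-string over the disjoint alphabets Σ (static) and Π (parameter):
-- disjointness is modelled by the disjoint sum Σ ⊎ Π.
PString : Set → Set → Set
PString S P = List (S ⊎ P)

act : {S P : Set} → (P ↔ P) → PString S P → PString S P
act f = map (map₂ (Inverse.to f))

_≡ᵖ_ : {S P : Set} → PString S P → PString S P → Set
_≡ᵖ_ {S} {P} x y = Σ (P ↔ P) (λ f → act f x ≡ y)

IsPeriod : {S P : Set} → PString S P → ℕ → Set
IsPeriod w p = (1 ≤ p) × (p ≤ length w) × (take (length w ∸ p) w ≡ᵖ drop p w)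

params : {S P : Set} → PString S P → List P
params [] = []
params (inj₁ _ ∷ w) = params w
params (inj₂ a ∷ w) = a ∷ params w

numParams : {S P : Set} → DecidableEquality P → PString S P → ℕ
numParams _≟_ w = length (deduplicate _≟_ (params w))

{-# OPTIONS --safe #-}
module Submission where

-- Write k = |Π_w|.  Since two p-strings are p-equivalent iff they have the same static letters
-- and the same equality pattern, d is a period of w iff the shift by d preserves static letters
-- and, for positions i, j with i + d, j + d < |w|, the letters at i, j agree exactly when those
-- at i + d, j + d do; the renaming of parameters is rebuilt from the pattern one transposition
-- at a time.
-- If p and q = p + r are periods and |w| ≥ q + k·p, then so is r: pairs of positions below
-- |w| − q go up by q and back down by p, pairs at or above p go down by p and up by q.  In a
-- remaining pair one position is below p and the other, y, is at least |w| − q ≥ k·p; among the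
-- k + 1 letters at y − k·p, …, y − p, y two parameters coincide, and shifting by multiples of p
-- produces y′ = y − l·p (l < k) such that y′, y and also y′ + r, y + r carry equal letters; this
-- reduces the pair to the first case.
-- The bound max(p, q) + k·min(p, q) ≤ |w| survives Euclid's algorithm, which ends at gcd(p, q).

open import Defs
open import Data.Nat using (ℕ; _≤_; _+_; _*_; _∸_; _⊓_)
open import Data.Nat.GCD using (gcd)
open import Data.List using (List; length)
open import Data.List.Membership.Propositional using (_∈_)
open import Data.Sum using (_⊎_; inj₂)
open import Data.Product using (∃)
open import Relation.Binary.Definitions using (DecidableEquality)

open import Data.Empty using (⊥-elim)
open import Data.Fin using (Fin; toℕ)
import Data.Fin as Fin
open import Data.Fin.Properties using (toℕ<n; pigeonhole)
open import Data.List using ([]; _∷_; map; take; drop; deduplicate; lookup)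
open import Data.List.Membership.Propositional.Properties using (∈-deduplicate⁺)
open import Data.List.Properties using (map-cong-local; length-take; length-drop)
import Data.List.Relation.Unary.All as All
open import Data.List.Relation.Unary.Any using (here; there; any?)
import Data.List.Relation.Unary.Any as Any
open import Data.List.Relation.Unary.Any.Properties using (lookup-index)
open import Data.Maybe using (Maybe; just; nothing)
import Data.Maybe as Maybe
open import Data.Maybe.Properties using (just-injective)
open import Data.Nat using (zero; suc; _<_; _>_; z≤n; s≤s; _≤?_; _<?_; >-nonZero)
open import Data.Nat.Divisibility using (∣-antisym; ∣m+n∣m⇒∣n; ∣m∣n⇒∣m+n; ∣⇒≤)
open import Data.Nat.GCD using (gcd[m,n]∣m; gcd[m,n]∣n; gcd-greatest; gcd-comm; gcd-identityʳ; gcd[m,n]≢0)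
open import Data.Nat.Induction using (<-wellFounded)
open import Data.Nat.Properties
open import Algebra.Properties.CommutativeSemigroup +-commutativeSemigroup using (x∙yz≈y∙xz)
open import Data.Nat.Tactic.RingSolver using (solve)
open import Data.Product using (_,_; proj₁; proj₂; _×_; ∃₂)
open import Data.Sum using (inj₁; map₂)
open import Data.Sum.Properties using (inj₂-injective)
open import Data.Unit using (⊤; tt)
open import Function using (_∘_)
open import Function.Bundles using (_↔_; _⇔_; Inverse; Injection; Equivalence; mk↔ₛ′; mk⇔)
open import Function.Construct.Composition using (_↔-∘_)
open import Function.Construct.Identity using (↔-id; ⇔-id)
open import Function.Construct.Symmetry using (⇔-sym)
open import Function.Properties.Inverse using (↔⇒↣)
open import Function.Related.Propositional using (module EquationalReasoning)
open import Induction.WellFounded using (Acc; acc)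
open import Relation.Binary.PropositionalEquality
open import Relation.Nullary using (¬_; Dec; yes; no)
open import Relation.Nullary.Decidable using (_×-dec_; map′)

module _ {A : Set} where

  infixl 9 _!_
  _!_ : List A → ℕ → Maybe A
  []       ! _     = nothing
  (x ∷ xs) ! zero  = just x
  (x ∷ xs) ! suc i = xs ! i

  !-take : ∀ {m i} (xs : List A) → i < m → take m xs ! i ≡ xs ! i
  !-take {suc m} []       _         = refl
  !-take {suc m} {zero}  (x ∷ xs) _         = refl
  !-take {suc m} {suc i} (x ∷ xs) (s≤s i<m) = !-take xs i<m

  !-drop : ∀ d (xs : List A) i → drop d xs ! i ≡ xs ! (d + i)
  !-drop zero    xs       i = refl
  !-drop (suc d) []       i = refl
  !-drop (suc d) (x ∷ xs) i = !-drop d xs i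

  !-defined : ∀ (xs : List A) {i} → i < length xs → ∃ λ x → xs ! i ≡ just x
  !-defined (x ∷ xs) {zero}  _         = x , refl
  !-defined (x ∷ xs) {suc i} (s≤s i<n) = !-defined xs i<n

  ∈⇒! : ∀ {x} {xs : List A} → x ∈ xs → ∃ λ i → i < length xs × xs ! i ≡ just x
  ∈⇒! (here refl) = zero , s≤s z≤n , refl
  ∈⇒! (there x∈xs) with ∈⇒! x∈xs
  ... | i , i<n , eq = suc i , s≤s i<n , eq

  !⇒∈ : ∀ (xs : List A) {i x} → xs ! i ≡ just x → x ∈ xs
  !⇒∈ (y ∷ xs) {zero}  refl = here refl
  !⇒∈ (y ∷ xs) {suc i} eq   = there (!⇒∈ xs eq)

!-map : ∀ {A B : Set} (f : A → B) (xs : List A) i → map f xs ! i ≡ Maybe.map f (xs ! i)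
!-map f []       i       = refl
!-map f (x ∷ xs) zero    = refl
!-map f (x ∷ xs) (suc i) = !-map f xs i

module Transposition {P : Set} (_≟_ : DecidableEquality P) where

  transpose : P → P → P → P
  transpose a b c with c ≟ a
  ... | yes _ = b
  ... | no _ with c ≟ b
  ...   | yes _ = a
  ...   | no _  = c

  transpose-left : ∀ a b → transpose a b a ≡ b
  transpose-left a b with a ≟ a
  ... | yes _  = refl
  ... | no a≢a = ⊥-elim (a≢a refl)

  transpose-right : ∀ a b → transpose a b b ≡ a
  transpose-right a b with b ≟ a
  ... | yes b≡a = b≡a
  ... | no _ with b ≟ b
  ...   | yes _  = refl
  ...   | no b≢b = ⊥-elim (b≢b refl)

  transpose-fixes : ∀ {a b c} → c ≢ a → c ≢ b → transpose a b c ≡ c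
  transpose-fixes {a} {b} {c} c≢a c≢b with c ≟ a
  ... | yes c≡a = ⊥-elim (c≢a c≡a)
  ... | no _ with c ≟ b
  ...   | yes c≡b = ⊥-elim (c≢b c≡b)
  ...   | no _    = refl

  transpose-involutive : ∀ a b c → transpose a b (transpose a b c) ≡ c
  transpose-involutive a b c with c ≟ a
  ... | yes refl = transpose-right c b
  ... | no c≢a with c ≟ b
  ...   | yes refl = transpose-left a c
  ...   | no c≢b   = transpose-fixes c≢a c≢b

  transposition : P → P → P ↔ P
  transposition a b =
    mk↔ₛ′ (transpose a b) (transpose a b) (transpose-involutive a b) (transpose-involutive a b)

module _ {S P : Set} where

  erase : Maybe (S ⊎ P) → Maybe (S ⊎ ⊤)
  erase nothing          = nothing
  erase (just (inj₁ s))  = just (inj₁ s)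
  erase (just (inj₂ _))  = just (inj₂ tt)

  rename : P ↔ P → Maybe (S ⊎ P) → Maybe (S ⊎ P)
  rename f = Maybe.map (map₂ (Inverse.to f))

  erase-rename : ∀ f c → erase (rename f c) ≡ erase c
  erase-rename f nothing         = refl
  erase-rename f (just (inj₁ _)) = refl
  erase-rename f (just (inj₂ _)) = refl

  rename-injective : ∀ f {c d} → rename f c ≡ rename f d → c ≡ d
  rename-injective f {nothing}        {nothing}        _  = refl
  rename-injective f {just (inj₁ s)}  {just (inj₁ s)}  refl = refl
  rename-injective f {just (inj₂ a)}  {just (inj₂ b)}  eq =
    cong (just ∘ inj₂) (Injection.injective (↔⇒↣ f) (inj₂-injective (just-injective eq)))
  rename-injective f {nothing}        {just _}         ()
  rename-injective f {just _}         {nothing}        ()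
  rename-injective f {just (inj₁ _)}  {just (inj₂ _)}  ()
  rename-injective f {just (inj₂ _)}  {just (inj₁ _)}  ()

  !-act : ∀ f (xs : PString S P) i → act f xs ! i ≡ rename f (xs ! i)
  !-act f = !-map (map₂ (Inverse.to f))

  record SameShapeOn (D : ℕ → Set) (x y : ℕ → Maybe (S ⊎ P)) : Set where
    field
      equalities : ∀ {i j} → D i → D j → x i ≡ x j ⇔ y i ≡ y j
      erasures   : ∀ {i} → D i → erase (x i) ≡ erase (y i)
  open SameShapeOn public

  sameShapeOn-transport : ∀ {D D′ : ℕ → Set} {x y x′ y′} →
    (∀ {i} → D′ i → D i) → (∀ {i} → D′ i → x′ i ≡ x i) → (∀ {i} → D′ i → y′ i ≡ y i) →
    SameShapeOn D x y → SameShapeOn D′ x′ y′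
  sameShapeOn-transport D′⊆D x′≗x y′≗y sh = record
    { equalities = λ {i} {j} di dj → mk⇔
        (λ e → trans (y′≗y di) (trans (Equivalence.to (equalities sh (D′⊆D di) (D′⊆D dj))
                 (trans (sym (x′≗x di)) (trans e (x′≗x dj)))) (sym (y′≗y dj))))
        (λ e → trans (x′≗x di) (trans (Equivalence.from (equalities sh (D′⊆D di) (D′⊆D dj))
                 (trans (sym (y′≗y di)) (trans e (y′≗y dj)))) (sym (x′≗x dj))))
    ; erasures = λ di → trans (cong erase (x′≗x di))
                   (trans (erasures sh (D′⊆D di)) (sym (cong erase (y′≗y di))))
    }

  ≡ᵖ⇒sameShape : ∀ {xs ys : PString S P} → xs ≡ᵖ ys → SameShapeOn (λ _ → ⊤) (xs !_) (ys !_)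
  ≡ᵖ⇒sameShape {xs} (f , refl) = record
    { equalities = λ {i} {j} _ _ → mk⇔
        (λ e → trans (!-act f xs i) (trans (cong (rename f) e) (sym (!-act f xs j))))
        (λ e → rename-injective f (trans (sym (!-act f xs i)) (trans e (!-act f xs j))))
    ; erasures = λ {i} _ → sym (trans (cong erase (!-act f xs i)) (erase-rename f (xs ! i)))
    }

  module _ (_≟_ : DecidableEquality P) where
    open Transposition _≟_

    private
      inj₂_≟_ : ∀ a (c : S ⊎ P) → Dec (inj₂ a ≡ c)
      inj₂ a ≟ inj₁ _ = no λ ()
      inj₂ a ≟ inj₂ b = map′ (cong inj₂) inj₂-injective (a ≟ b)

    ≡ᵖ-∷ : ∀ {x y} {xs ys : PString S P} →
      SameShapeOn (_< suc (length xs)) ((x ∷ xs) !_) ((y ∷ ys) !_) →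
      xs ≡ᵖ ys → (x ∷ xs) ≡ᵖ (y ∷ ys)
    ≡ᵖ-∷ {inj₁ s} {inj₁ t} sh (f , refl) with erasures sh (s≤s z≤n)
    ... | refl = f , refl
    ≡ᵖ-∷ {inj₁ s} {inj₂ b} sh _ with erasures sh (s≤s z≤n)
    ... | ()
    ≡ᵖ-∷ {inj₂ a} {inj₁ t} sh _ with erasures sh (s≤s z≤n)
    ... | ()
    ≡ᵖ-∷ {inj₂ a} {inj₂ b} {xs} sh (f , refl) with any? (inj₂_≟_ a) xs
    ... | yes a∈xs = f , cong (_∷ act f xs) (cong inj₂ fa≡b)
      where
        fa≡b : Inverse.to f a ≡ b
        fa≡b with ∈⇒! a∈xs
        ... | i , i<n , xs!i≡a = inj₂-injective (just-injective (begin
          just (inj₂ (Inverse.to f a)) ≡⟨ cong (rename f) xs!i≡a ⟨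
          rename f (xs ! i)            ≡⟨ !-act f xs i ⟨
          act f xs ! i                 ≡⟨ Equivalence.to (equalities sh (s≤s z≤n) (s≤s i<n)) (sym xs!i≡a) ⟨
          just (inj₂ b)                ∎))
          where open ≡-Reasoning
    -- a is new: correct f by the transposition of f a and b, which fixes the images of the
    -- letters of xs
    ... | no a∉xs = transposition (Inverse.to f a) b ↔-∘ f ,
                    cong₂ _∷_ (cong inj₂ (transpose-left _ b)) (sym (map-cong-local (All.tabulate fixed)))
      where
        fixed : ∀ {c} → c ∈ xs → map₂ (Inverse.to f) c ≡ map₂ (transpose (Inverse.to f a) b ∘ Inverse.to f) c
        fixed {inj₁ _} _ = refl
        fixed {inj₂ c} c∈xs with ∈⇒! c∈xs
        ... | i , i<n , xs!i≡c = cong inj₂ (sym (transpose-fixes fc≢fa fc≢b))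
          where
            fc≢fa : Inverse.to f c ≢ Inverse.to f a
            fc≢fa fc≡fa = a∉xs (subst (λ d → inj₂ d ∈ xs) (Injection.injective (↔⇒↣ f) fc≡fa) c∈xs)
            fc≢b : Inverse.to f c ≢ b
            fc≢b fc≡b = a∉xs (!⇒∈ xs (sym (Equivalence.from (equalities sh (s≤s z≤n) (s≤s i<n)) (begin
              just (inj₂ b)                ≡⟨ cong (just ∘ inj₂) fc≡b ⟨
              just (inj₂ (Inverse.to f c)) ≡⟨ cong (rename f) xs!i≡c ⟨
              rename f (xs ! i)            ≡⟨ !-act f xs i ⟨
              act f xs ! i                 ∎))))
              where open ≡-Reasoning

    sameShape⇒≡ᵖ : ∀ (xs ys : PString S P) → length xs ≡ length ys →
      SameShapeOn (_< length xs) (xs !_) (ys !_) → xs ≡ᵖ ys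
    sameShape⇒≡ᵖ []       []       _   _  = ↔-id P , refl
    sameShape⇒≡ᵖ (x ∷ xs) (y ∷ ys) len sh = ≡ᵖ-∷ sh (sameShape⇒≡ᵖ xs ys (suc-injective len) tail)
      where
        tail : SameShapeOn (_< length xs) (xs !_) (ys !_)
        tail = record { equalities = λ i<n j<n → equalities sh (s≤s i<n) (s≤s j<n)
                      ; erasures   = λ i<n → erasures sh (s≤s i<n) }

IsParameter : {S P : Set} → Maybe (S ⊎ P) → Set
IsParameter {P = P} c = ∃ λ (a : P) → c ≡ just (inj₂ a)

erase-parameter : ∀ {S P : Set} {c d : Maybe (S ⊎ P)} →
  erase c ≡ erase d → IsParameter c → IsParameter d
erase-parameter {d = just (inj₂ b)} _ _ = b , refl
erase-parameter {d = nothing}        () (_ , refl)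
erase-parameter {d = just (inj₁ _)}  () (_ , refl)

erase-static : ∀ {S P : Set} {c d : Maybe (S ⊎ P)} {s} →
  erase c ≡ erase d → c ≡ just (inj₁ s) → d ≡ just (inj₁ s)
erase-static {d = just (inj₁ _)} refl refl = refl
erase-static {d = nothing}        () refl
erase-static {d = just (inj₂ _)}  () refl

gcd[m,m+n]≡gcd[m,n] : ∀ m n → gcd m (m + n) ≡ gcd m n
gcd[m,m+n]≡gcd[m,n] m n = ∣-antisym
  (gcd-greatest (gcd[m,n]∣m m (m + n)) (∣m+n∣m⇒∣n (gcd[m,n]∣n m (m + n)) (gcd[m,n]∣m m (m + n))))
  (gcd-greatest (gcd[m,n]∣m m n) (∣m∣n⇒∣m+n (gcd[m,n]∣m m n) (gcd[m,n]∣n m n)))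

gcd[m,n]>0 : ∀ {m} n → m > 0 → gcd m n > 0
gcd[m,n]>0 {m} n m>0 = n≢0⇒n>0 (gcd[m,n]≢0 m n (inj₁ (n>0⇒n≢0 m>0)))

gcd[m,n]≤m : ∀ {m} n → m > 0 → gcd m n ≤ m
gcd[m,n]≤m n m>0 = ∣⇒≤ {{>-nonZero m>0}} (gcd[m,n]∣m _ n)

m+n+[m⊓n]*[k∸1]≡n+k*m : ∀ {k m n} → 1 ≤ k → m ≤ n → m + n + (m ⊓ n) * (k ∸ 1) ≡ n + k * m
m+n+[m⊓n]*[k∸1]≡n+k*m {suc k} {m} {n} _ m≤n =
  trans (cong (λ c → m + n + c * k) (m≤n⇒m⊓n≡m m≤n)) identity
  where
    identity : m + n + m * k ≡ n + suc k * m
    identity = solve (k ∷ m ∷ n ∷ [])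

∈-params : ∀ {S P : Set} (w : PString S P) {a} → inj₂ a ∈ w → a ∈ params w
∈-params (inj₂ _ ∷ w) (here refl) = here refl
∈-params (inj₁ _ ∷ w) (there a∈w) = ∈-params w a∈w
∈-params (inj₂ _ ∷ w) (there a∈w) = there (∈-params w a∈w)

module Periods {S P : Set} (w : PString S P) where

  n : ℕ
  n = length w

  W : ℕ → Maybe (S ⊎ P)
  W = w !_

  infix 4 _∼_
  _∼_ : ℕ → ℕ → Set
  i ∼ j = W i ≡ W j

  Period : ℕ → Set
  Period d = SameShapeOn (λ i → d + i < n) W (λ i → W (d + i))

  private
    <∸⇔+< : ∀ {d i} → d ≤ n → i < n ∸ d ⇔ d + i < n
    <∸⇔+< {d} {i} d≤n = mk⇔
      (λ i<n∸d → subst (_≤ n) (cong suc (+-comm i d)) (m≤o∸n⇒m+n≤o (suc i) d≤n i<n∸d))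
      (λ d+i<n → m+n≤o⇒m≤o∸n (suc i) (subst (_≤ n) (cong suc (+-comm d i)) d+i<n))

  isPeriod⇒Period : ∀ {d} → IsPeriod w d → Period d
  isPeriod⇒Period {d} (_ , d≤n , take≡ᵖdrop) = sameShapeOn-transport _
    (λ d+i<n → sym (!-take w (Equivalence.from (<∸⇔+< d≤n) d+i<n)))
    (λ {i} _ → sym (!-drop d w i))
    (≡ᵖ⇒sameShape take≡ᵖdrop)

  Period⇒isPeriod : DecidableEquality P → ∀ {d} → 1 ≤ d → d ≤ n → Period d → IsPeriod w d
  Period⇒isPeriod _≟_ {d} 1≤d d≤n per = 1≤d , d≤n ,
    sameShape⇒≡ᵖ _≟_ (take (n ∸ d) w) (drop d w) (trans |take| (sym (length-drop d w)))
      (sameShapeOn-transport (Equivalence.to (<∸⇔+< d≤n) ∘ subst (_ <_) |take|)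
        (λ i<len → !-take w (subst (_ <_) |take| i<len))
        (λ {i} _ → !-drop d w i)
        per)
    where
      |take| : length (take (n ∸ d) w) ≡ n ∸ d
      |take| = trans (length-take (n ∸ d) w) (m≤n⇒m⊓n≡m (m∸n≤m n d))

  ≡⇒∼ : ∀ {x y} → x ≡ y → x ∼ y
  ≡⇒∼ = cong W

  ∼-replaceʳ : ∀ {x y y′} → y ∼ y′ → x ∼ y ⇔ x ∼ y′
  ∼-replaceʳ y∼y′ = mk⇔ (λ e → trans e y∼y′) (λ e → trans e (sym y∼y′))

  ∼-flip : ∀ {x y x′ y′} → y ∼ x ⇔ y′ ∼ x′ → x ∼ y ⇔ x′ ∼ y′
  ∼-flip e = mk⇔ (λ x∼y → sym (Equivalence.to e (sym x∼y)))
                 (λ x′∼y′ → sym (Equivalence.from e (sym x′∼y′)))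

  static-transfer : ∀ {x y x′ y′ s} → erase (W x) ≡ erase (W x′) → erase (W y) ≡ erase (W y′) →
    W y ≡ just (inj₁ s) → x ∼ y ⇔ x′ ∼ y′
  static-transfer ex ey y≡s = mk⇔
    (λ x∼y → trans (erase-static ex (trans x∼y y≡s)) (sym (erase-static ey y≡s)))
    (λ x′∼y′ → trans (erase-static (sym ex) (trans x′∼y′ (erase-static ey y≡s))) (sym y≡s))

  module Multiples {p} (per : Period p) where

    private
      peel : ∀ m x → p + m * p + x < n → p + (m * p + x) < n
      peel m x = subst (_< n) (+-assoc p (m * p) x)

      below : ∀ m x → p + m * p + x < n → m * p + x < n
      below m x h = ≤-<-trans (m≤n+m (m * p + x) p) (peel m x h)

    shift : ∀ m {x y} → m * p + x < n → m * p + y < n → x ∼ y ⇔ m * p + x ∼ m * p + y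
    shift zero {x} {y} _  _  = ⇔-id (x ∼ y)
    shift (suc m) {x} {y} hx hy = begin
      x ∼ y                             ∼⟨ shift m (below m x hx) (below m y hy) ⟩
      m * p + x ∼ m * p + y             ∼⟨ equalities per (peel m x hx) (peel m y hy) ⟩
      p + (m * p + x) ∼ p + (m * p + y) ≡⟨ cong₂ _∼_ (sym (+-assoc p (m * p) x)) (sym (+-assoc p (m * p) y)) ⟩
      p + m * p + x ∼ p + m * p + y     ∎
      where open EquationalReasoning

    erase-shift : ∀ m {x} → m * p + x < n → erase (W x) ≡ erase (W (m * p + x))
    erase-shift zero          _  = refl
    erase-shift (suc m) {x} hx = begin
      erase (W x)                 ≡⟨ erase-shift m (below m x hx) ⟩
      erase (W (m * p + x))       ≡⟨ erasures per (peel m x hx) ⟩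
      erase (W (p + (m * p + x))) ≡⟨ cong (erase ∘ W) (+-assoc p (m * p) x) ⟨
      erase (W (p + m * p + x))   ∎
      where open ≡-Reasoning

    stack : ∀ a b x → a * p + (b * p + x) ≡ (a + b) * p + x
    stack a b x = solve (a ∷ b ∷ x ∷ p ∷ [])

  module ParameterCount (_≟_ : DecidableEquality P) where

    k : ℕ
    k = numParams _≟_ w

    Param : ℕ → Set
    Param x = IsParameter (W x)

    _≟-parameter_ : ∀ (c : Maybe (S ⊎ P)) a → Dec (c ≡ just (inj₂ a))
    nothing       ≟-parameter a = no λ ()
    just (inj₁ _) ≟-parameter a = no λ ()
    just (inj₂ b) ≟-parameter a = map′ (cong (just ∘ inj₂)) (inj₂-injective ∘ just-injective) (b ≟ a)

    private
      distinct : List P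
      distinct = deduplicate _≟_ (params w)

      slot : ∀ {a} → inj₂ a ∈ w → Fin k
      slot a∈w = Any.index (∈-deduplicate⁺ _≟_ (∈-params w a∈w))

      slot-letter : ∀ {a} (a∈w : inj₂ a ∈ w) → a ≡ lookup distinct (slot a∈w)
      slot-letter a∈w = lookup-index (∈-deduplicate⁺ _≟_ (∈-params w a∈w))

    1≤k : ∀ {a} → inj₂ a ∈ w → 1 ≤ k
    1≤k a∈w = ≤-<-trans z≤n (toℕ<n (slot a∈w))

    parameters-collide : (pos : Fin (suc k) → ℕ) → (∀ t → Param (pos t)) →
      ∃₂ λ s t → s Fin.< t × pos s ∼ pos t
    parameters-collide pos param
      with pigeonhole (n<1+n k) (λ t → slot (!⇒∈ w (proj₂ (param t))))
    ... | s , t , s<t , same = s , t , s<t , (begin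
      W (pos s)                        ≡⟨ proj₂ (param s) ⟩
      just (inj₂ (proj₁ (param s)))    ≡⟨ cong (just ∘ inj₂) (slot-letter _) ⟩
      just (inj₂ (lookup distinct _))  ≡⟨ cong (just ∘ inj₂ ∘ lookup distinct) same ⟩
      just (inj₂ (lookup distinct _))  ≡⟨ cong (just ∘ inj₂) (slot-letter _) ⟨
      just (inj₂ (proj₁ (param t)))    ≡⟨ proj₂ (param t) ⟨
      W (pos t)                        ∎)
      where open ≡-Reasoning

    -- If the letter at k·p + u does not recur at l·p + u for 0 < l < k, the k letters at
    -- p + u, …, k·p + u are pairwise distinct, so every parameter letter of w is one of them.
    module Run {p} (per : Period p) (u : ℕ) (top<n : k * p + u < n) (top : Param (k * p + u))
               (fresh : ∀ {l} → 1 ≤ l → l < k → ¬ (l * p + u ∼ k * p + u)) where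
      open Multiples per

      private
        lift : ∀ {b} → b ≤ k → ∀ x → (k ∸ b) * p + (b * p + x) ≡ k * p + x
        lift {b} b≤k x = trans (stack (k ∸ b) b x) (cong (λ c → c * p + x) (m∸n+n≡m b≤k))

        lift′ : ∀ {b} → b ≤ k → ∀ x → b * p + ((k ∸ b) * p + x) ≡ k * p + x
        lift′ {b} b≤k x = trans (stack b (k ∸ b) x) (cong (λ c → c * p + x) (m+[n∸m]≡n b≤k))

        lifted<n : ∀ {b x} → b ≤ k → k * p + x < n → (k ∸ b) * p + (b * p + x) < n
        lifted<n {x = x} b≤k = subst (_< n) (sym (lift b≤k x))

        on-run : ∀ {b} → b ≤ k → b * p + u < n
        on-run b≤k = ≤-<-trans (+-monoˡ-≤ u (*-monoˡ-≤ p b≤k)) top<n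

        param-on-run : ∀ {b} → b ≤ k → Param (b * p + u)
        param-on-run {b} b≤k = erase-parameter (sym (erase-shift (k ∸ b) (lifted<n b≤k top<n)))
          (subst Param (sym (lift b≤k u)) top)

      run-distinct : ∀ {a b} → 1 ≤ a → a < b → b ≤ k → ¬ (a * p + u ∼ b * p + u)
      run-distinct {a} {b} 1≤a a<b b≤k a∼b = fresh 1≤l l<k (begin
        W ((k ∸ b + a) * p + u)       ≡⟨ ≡⇒∼ (stack (k ∸ b) a u) ⟨
        W ((k ∸ b) * p + (a * p + u)) ≡⟨ Equivalence.to (shift (k ∸ b) lifted-a<n (lifted<n b≤k top<n)) a∼b ⟩
        W ((k ∸ b) * p + (b * p + u)) ≡⟨ ≡⇒∼ (lift b≤k u) ⟩
        W (k * p + u)                 ∎)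
        where
          open ≡-Reasoning
          1≤l : 1 ≤ k ∸ b + a
          1≤l = ≤-trans 1≤a (m≤n+m a (k ∸ b))
          l<k : k ∸ b + a < k
          l<k = subst (k ∸ b + a <_) (m∸n+n≡m b≤k) (+-monoʳ-< (k ∸ b) a<b)
          lifted-a<n : (k ∸ b) * p + (a * p + u) < n
          lifted-a<n = ≤-<-trans (+-monoʳ-≤ ((k ∸ b) * p) (+-monoˡ-≤ u (*-monoˡ-≤ p (<⇒≤ a<b))))
                                 (lifted<n b≤k top<n)

      private
        run : ℕ → Fin (suc k) → ℕ
        run x Fin.zero    = x
        run x (Fin.suc t) = suc (toℕ t) * p + u

        param-run : ∀ {x} → Param x → ∀ t → Param (run x t)
        param-run px Fin.zero    = px
        param-run px (Fin.suc t) = param-on-run (toℕ<n t)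

      run-absorbs : ∀ {x} → Param x → ∃ λ b → 1 ≤ b × b ≤ k × x ∼ b * p + u
      run-absorbs {x} px with parameters-collide (run x) (param-run px)
      ... | Fin.zero  , Fin.zero  , () , _
      ... | Fin.suc _ , Fin.zero  , () , _
      ... | Fin.zero  , Fin.suc t , _   , x∼  = suc (toℕ t) , s≤s z≤n , toℕ<n t , x∼
      ... | Fin.suc s , Fin.suc t , s<t , same = ⊥-elim (run-distinct (s≤s z≤n) s<t (toℕ<n t) same)

      run-closed : u ∼ k * p + u
      run-closed = closes (run-absorbs (param-on-run z≤n))
        where
          closes : (∃ λ b → 1 ≤ b × b ≤ k × u ∼ b * p + u) → u ∼ k * p + u
          closes (b , 1≤b , b≤k , u∼b) with m≤n⇒m<n∨m≡n b≤k
          ... | inj₂ b≡k = subst (λ c → u ∼ c * p + u) b≡k u∼b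
          ... | inj₁ b<k = ⊥-elim (fresh (m<n⇒0<n∸m b<k) (∸-monoʳ-< 1≤b b≤k) (trans
                  (Equivalence.to (shift (k ∸ b) (≤-<-trans (+-monoʳ-≤ _ (m≤n+m u _)) (lifted<n b≤k top<n))
                                                 (lifted<n b≤k top<n)) u∼b)
                  (≡⇒∼ (lift b≤k u))))

      run-periodic : ∀ {v} → k * p + v < n → Param (k * p + v) → v ∼ k * p + v
      run-periodic {v} top′<n top′ with run-absorbs top′
      ... | b , _ , b≤k , top′∼b = trans v∼b (sym top′∼b)
        where
          [k∸b]+v∼u : (k ∸ b) * p + v ∼ u
          [k∸b]+v∼u = Equivalence.from (shift b (subst (_< n) (sym (lift′ b≤k v)) top′<n) (on-run b≤k))
                        (trans (≡⇒∼ (lift′ b≤k v)) top′∼b)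
          v∼b : v ∼ b * p + u
          v∼b = Equivalence.from
            (shift (k ∸ b) (≤-<-trans (+-monoʳ-≤ _ (m≤n+m v (b * p))) (lifted<n b≤k top′<n)) (lifted<n b≤k top<n))
            (trans [k∸b]+v∼u (trans run-closed (≡⇒∼ (sym (lift b≤k u)))))

    module Difference {p r} (per-p : Period p) (per-q : Period (p + r)) (1≤k : 1 ≤ k)
                      (long : p + r + k * p ≤ n) where
      open Multiples per-p

      private
        q : ℕ
        q = p + r

        p≤l*p : ∀ {l} → 1 ≤ l → p ≤ l * p
        p≤l*p {l} 1≤l = subst (_≤ l * p) (*-identityˡ p) (*-monoˡ-≤ p 1≤l)

        q+p≤n : q + p ≤ n
        q+p≤n = ≤-trans (+-monoʳ-≤ q (p≤l*p 1≤k)) long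

        far⇒p≤ : ∀ {x} → ¬ (q + x < n) → p ≤ x
        far⇒p≤ {x} far = +-cancelˡ-≤ q p x (≤-trans q+p≤n (≮⇒≥ far))

        far⇒kp≤ : ∀ {x} → ¬ (q + x < n) → k * p ≤ x
        far⇒kp≤ {x} far = +-cancelˡ-≤ q (k * p) x (≤-trans long (≮⇒≥ far))

        q+x≡p+[r+x] : ∀ x → q + x ≡ p + (r + x)
        q+x≡p+[r+x] = +-assoc p r

        q+x≡r+[p+x] : ∀ x → q + x ≡ r + (p + x)
        q+x≡r+[p+x] x = trans (cong (_+ x) (+-comm p r)) (+-assoc r p x)

      low : ∀ {x y} → q + x < n → q + y < n → x ∼ y ⇔ r + x ∼ r + y
      low {x} {y} hx hy = begin
        x ∼ y                     ∼⟨ equalities per-q hx hy ⟩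
        q + x ∼ q + y             ≡⟨ cong₂ _∼_ (q+x≡p+[r+x] x) (q+x≡p+[r+x] y) ⟩
        p + (r + x) ∼ p + (r + y) ∼⟨ ⇔-sym (equalities per-p (subst (_< n) (q+x≡p+[r+x] x) hx)
                                                              (subst (_< n) (q+x≡p+[r+x] y) hy)) ⟩
        r + x ∼ r + y             ∎
        where open EquationalReasoning

      high : ∀ {x y} → p ≤ x → p ≤ y → r + x < n → r + y < n → x ∼ y ⇔ r + x ∼ r + y
      high p≤x p≤y with m≤n⇒∃[o]m+o≡n p≤x | m≤n⇒∃[o]m+o≡n p≤y
      ... | x , refl | y , refl = λ hx hy → begin
        p + x ∼ p + y             ∼⟨ ⇔-sym (equalities per-p (≤-<-trans (m≤n+m _ r) hx)
                                                             (≤-<-trans (m≤n+m _ r) hy)) ⟩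
        x ∼ y                     ∼⟨ equalities per-q (subst (_< n) (sym (q+x≡r+[p+x] x)) hx)
                                                     (subst (_< n) (sym (q+x≡r+[p+x] y)) hy) ⟩
        q + x ∼ q + y             ≡⟨ cong₂ _∼_ (q+x≡r+[p+x] x) (q+x≡r+[p+x] y) ⟩
        r + (p + x) ∼ r + (p + y) ∎
        where open EquationalReasoning

      erase-r : ∀ {x} → r + x < n → erase (W x) ≡ erase (W (r + x))
      erase-r {x} hx with q + x <? n
      ... | yes near = begin
        erase (W x)             ≡⟨ erasures per-q near ⟩
        erase (W (q + x))       ≡⟨ cong (erase ∘ W) (q+x≡p+[r+x] x) ⟩
        erase (W (p + (r + x))) ≡⟨ erasures per-p (subst (_< n) (q+x≡p+[r+x] x) near) ⟨
        erase (W (r + x))       ∎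
        where open ≡-Reasoning
      ... | no far with m≤n⇒∃[o]m+o≡n (far⇒p≤ far)
      ...   | x′ , refl = begin
        erase (W (p + x′))       ≡⟨ erasures per-p (≤-<-trans (m≤n+m _ r) hx) ⟨
        erase (W x′)             ≡⟨ erasures per-q (subst (_< n) (sym (q+x≡r+[p+x] x′)) hx) ⟩
        erase (W (q + x′))       ≡⟨ cong (erase ∘ W) (q+x≡r+[p+x] x′) ⟩
        erase (W (r + (p + x′))) ∎
        where open ≡-Reasoning

      anchor : ∀ u → r + (k * p + u) < n → Param (k * p + u) →
        ∃ λ l → l < k × l * p + u ∼ k * p + u × r + (l * p + u) ∼ r + (k * p + u)
      anchor u h (a , top≡a) with anyUpTo? (λ l → 1 ≤? l ×-dec (W (l * p + u) ≟-parameter a)) k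
      ... | yes (l , l<k , 1≤l , l≡a) = l , l<k , l∼top , Equivalence.to (high p≤l p≤top r+l<n h) l∼top
        where
          l∼top : l * p + u ∼ k * p + u
          l∼top = trans l≡a (sym top≡a)
          p≤l : p ≤ l * p + u
          p≤l = ≤-trans (p≤l*p 1≤l) (m≤m+n _ u)
          p≤top : p ≤ k * p + u
          p≤top = ≤-trans (p≤l*p 1≤k) (m≤m+n _ u)
          r+l<n : r + (l * p + u) < n
          r+l<n = ≤-<-trans (+-monoʳ-≤ r (+-monoˡ-≤ u (*-monoˡ-≤ p (<⇒≤ l<k)))) h
      ... | no none = 0 , 1≤k , run-closed ,
          trans (run-periodic (subst (_< n) swap h) (subst Param swap (erase-parameter (erase-r h) (a , top≡a))))
                (≡⇒∼ (sym swap))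
        where
          open Run per-p u (≤-<-trans (m≤n+m _ r) h) (a , top≡a)
                   (λ 1≤l l<k l∼top → none (_ , l<k , 1≤l , trans l∼top top≡a))
          swap : r + (k * p + u) ≡ k * p + (r + u)
          swap = x∙yz≈y∙xz r (k * p) u

      mixed : ∀ {x} u → x < p → r + (k * p + u) < n → x ∼ k * p + u ⇔ r + x ∼ r + (k * p + u)
      mixed {x} u x<p h with !-defined w (≤-<-trans (m≤n+m _ r) h)
      ... | inj₁ s , top≡s = static-transfer (erase-r r+x<n) (erase-r h) top≡s
        where
          r+x<n : r + x < n
          r+x<n = ≤-<-trans (+-monoʳ-≤ r (≤-trans (<⇒≤ x<p) (≤-trans (p≤l*p 1≤k) (m≤m+n _ u)))) h
      ... | inj₂ a , top≡a with anchor u h (a , top≡a)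
      ...   | l , l<k , l∼top , r+l∼r+top = begin
        x ∼ k * p + u             ∼⟨ ∼-replaceʳ (sym l∼top) ⟩
        x ∼ l * p + u             ∼⟨ low (<-≤-trans (+-monoʳ-< q x<p) q+p≤n) q+l<n ⟩
        r + x ∼ r + (l * p + u)   ∼⟨ ∼-replaceʳ r+l∼r+top ⟩
        r + x ∼ r + (k * p + u)   ∎
        where
          open EquationalReasoning
          q+l≡r+sl : p + r + (l * p + u) ≡ r + (suc l * p + u)
          q+l≡r+sl = solve (p ∷ r ∷ l ∷ u ∷ [])
          q+l<n : q + (l * p + u) < n
          q+l<n = subst (_< n) (sym q+l≡r+sl) (≤-<-trans (+-monoʳ-≤ r (+-monoˡ-≤ u (*-monoˡ-≤ p l<k))) h)

      near-far : ∀ {x y} → r + x < n → r + y < n → ¬ (q + y < n) → x ∼ y ⇔ r + x ∼ r + y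
      near-far {x} hx hy far with p ≤? x | m≤n⇒∃[o]m+o≡n (far⇒kp≤ far)
      ... | yes p≤x | _        = high p≤x (far⇒p≤ far) hx hy
      ... | no  p≰x | u , refl = mixed u (≰⇒> p≰x) hy

      difference-period : Period r
      difference-period = record { equalities = shifts ; erasures = erase-r }
        where
          shifts : ∀ {x y} → r + x < n → r + y < n → x ∼ y ⇔ r + x ∼ r + y
          shifts {x} {y} hx hy with q + x <? n | q + y <? n
          ... | yes near-x | yes near-y = low near-x near-y
          ... | no  far-x  | no  far-y  = high (far⇒p≤ far-x) (far⇒p≤ far-y) hx hy
          ... | _          | no  far-y  = near-far hx hy far-y
          ... | no  far-x  | yes _      = ∼-flip (near-far hy hx far-x)

    gcd-period-ordered : ∀ {p q} → Acc _<_ (p + q) → 1 ≤ k → 1 ≤ p → p ≤ q → q + k * p ≤ n →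
      Period p → Period q → Period (gcd p q)
    gcd-period-ordered {p} (acc smaller) 1≤k 1≤p p≤q long per-p per-q with m≤n⇒∃[o]m+o≡n p≤q
    ... | zero , refl = subst Period (sym (trans (gcd[m,m+n]≡gcd[m,n] p 0) (gcd-identityʳ p))) per-p
    ... | r@(suc _) , refl = subst Period (sym (gcd[m,m+n]≡gcd[m,n] p r)) (recurse (≤-total p r))
      where
        per-r : Period r
        per-r = Difference.difference-period per-p per-q 1≤k long

        p+r<p+q : p + r < p + (p + r)
        p+r<p+q = +-monoʳ-< p (m<n+m r 1≤p)

        recurse : p ≤ r ⊎ r ≤ p → Period (gcd p r)
        recurse (inj₁ p≤r) = gcd-period-ordered (smaller p+r<p+q) 1≤k 1≤p p≤r
          (≤-trans (+-monoˡ-≤ (k * p) (m≤n+m r p)) long) per-p per-r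
        recurse (inj₂ r≤p) = subst Period (gcd-comm r p) (gcd-period-ordered
          (smaller (subst (_< p + (p + r)) (+-comm p r) p+r<p+q)) 1≤k (s≤s z≤n) r≤p
          (≤-trans (+-monoʳ-≤ p (*-monoʳ-≤ k r≤p)) (≤-trans (+-monoˡ-≤ (k * p) (m≤m+n p r)) long))
          per-r per-p)

    gcd-period : ∀ {p q} → 1 ≤ k → 1 ≤ p → 1 ≤ q → p + q + (p ⊓ q) * (k ∸ 1) ≤ n →
      Period p → Period q → Period (gcd p q)
    gcd-period {p} {q} 1≤k 1≤p 1≤q long per-p per-q with ≤-total p q
    ... | inj₁ p≤q = gcd-period-ordered (<-wellFounded _) 1≤k 1≤p p≤q
          (subst (_≤ n) (m+n+[m⊓n]*[k∸1]≡n+k*m 1≤k p≤q) long) per-p per-q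
    ... | inj₂ q≤p = subst Period (gcd-comm q p) (gcd-period-ordered (<-wellFounded _) 1≤k 1≤q q≤p
          (subst (_≤ n) (trans (cong₂ (λ a c → a + c * (k ∸ 1)) (+-comm p q) (⊓-comm p q))
                               (m+n+[m⊓n]*[k∸1]≡n+k*m 1≤k q≤p)) long) per-q per-p)

lemma5 : (S P : Set) (_≟_ : DecidableEquality P) (w : PString S P) (p q : ℕ) →
    ∃ (λ a → inj₂ a ∈ w) →
    IsPeriod w p → IsPeriod w q →
    p + q + (p ⊓ q) * (numParams _≟_ w ∸ 1) ≤ length w →
    IsPeriod w (gcd p q)
lemma5 S P _≟_ w p q (_ , a∈w) p-period@(1≤p , p≤n , _) q-period@(1≤q , _) long =
  Period⇒isPeriod _≟_ (gcd[m,n]>0 q 1≤p) (≤-trans (gcd[m,n]≤m q 1≤p) p≤n)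
    (gcd-period (1≤k a∈w) 1≤p 1≤q long (isPeriod⇒Period p-period) (isPeriod⇒Period q-period))
  where
    open Periods w
    open ParameterCount _≟_
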